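{- Let $n\ge1$, $\mu\in\mathbb{N}^n$, $u\in\mathrm{dg}'(\mu)$ and $v\in\widehat{\mathrm{dg}}(\mu)$. Then $v\in\mathrm{arm}(u)$ (computed in $\mu$) if and only if $\pi(v)\in\mathrm{arm}(\pi(u))$ (computed in $\pi(\mu)$).
   Context: For $\mu\in\mathbb{N}^n$, $\mathrm{dg}'(\mu)=\{(i,j)\in\mathbb{N}^2:1\le i\le n,\ 1\le j\le\mu_i\}$ and $\widehat{\mathrm{dg}}(\mu)=\mathrm{dg}'(\mu)\cup\{(i,0):1\le i\le n\}$. For $u=(i,j)\in\mathrm{dg}'(\mu)$, $\mathrm{arm}(u)=\{(i',j)\in\mathrm{dg}'(\mu):i'<i,\ \mu_{i'}\le\mu_i\}\cup\{(i',j-1)\in\widehat{\mathrm{dg}}(\mu):i'>i,\ \mu_{i'}<\mu_i\}$. Define $\pi(\mu)=(\mu_n+1,\mu_1,\dots,\mu_{n-1})$ and the map $\pi:\widehat{\mathrm{dg}}(\mu)\to\widehat{\mathrm{dg}}(\pi(\mu))$ by $\pi((i,j))=(i+1,j)$ for $i<n$ and $\pi((n,j))=(1,j+1)$. -}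

module Defs where

open import Data.Nat using (ℕ; zero; suc; _≤_; _<_; _∸_)
open import Data.Fin using (Fin; zero; suc; inject₁; fromℕ)
import Data.Fin as F
open import Data.Product using (_×_; _,_; ∃; ∃-syntax)
open import Data.Sum using (_⊎_)
open import Relation.Binary.PropositionalEquality using (_≡_)

-- A composition μ ∈ ℕ^n with n = suc m, indexed by Fin n
-- (Fin index k corresponds to the paper's row k+1).
Comp : ℕ → Set
Comp n = Fin n → ℕ

Cell : ℕ → Set
Cell n = Fin n × ℕ

_∈dg′_ : ∀ {n} → Cell n → Comp n → Set
(i , j) ∈dg′ μ = 1 ≤ j × j ≤ μ i

_∈dĝ_ : ∀ {n} → Cell n → Comp n → Set
(i , j) ∈dĝ μ = j ≤ μ i

_∈arm[_]_ : ∀ {n} → Cell n → Comp n → Cell n → Set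
v ∈arm[ μ ] (i , j) =
  (∃[ i′ ] (v ≡ (i′ , j) × (i′ , j) ∈dg′ μ × i′ F.< i × μ i′ ≤ μ i))
  ⊎ (∃[ i′ ] (v ≡ (i′ , j ∸ 1) × (i′ , j ∸ 1) ∈dĝ μ × i F.< i′ × μ i′ < μ i))

πc : ∀ {m} → Comp (suc m) → Comp (suc m)
πc {m} μ zero = suc (μ (fromℕ m))
πc {m} μ (suc k) = μ (inject₁ k)

-- π on cells: (i , j) ↦ (i+1 , j) for i < n, (n , j) ↦ (1 , j+1)
-- (in 0-based Fin indices: k ↦ k+1 for k not last, last ↦ 0 with j+1).
πcell : ∀ {m} → Cell (suc m) → Cell (suc m)
πcell {zero} (zero , j) = zero , suc j
πcell {suc m} (zero , j) = suc zero , j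
πcell {suc m} (suc k , j) with πcell {m} (k , j)
... | (zero , j′) = zero , j′
... | (suc k′ , j′) = suc (suc k′) , j′

-- π shifts every row but the last one step down, preserving lengths and relative
-- order, so arm membership between two such rows transfers verbatim.  The last
-- row wraps to the top, one column further right and one cell longer: relative to
-- any other row its position flips while the comparison μₙ ≤ μᵢ turns into
-- μₙ + 1 ≤ μᵢ, which swaps the left-arm condition (same column, μ_{i'} ≤ μᵢ) with
-- the right-arm one (previous column, μ_{i'} < μᵢ).  Two cells of the last row are
-- never in each other's arm, before or after π.

{-# OPTIONS --safe #-}
module Submission where

open import Defs
open import Data.Nat using (ℕ; zero; suc; _<_; z≤n; s≤s; s≤s⁻¹; s<s; s<s⁻¹)
import Data.Nat.Properties as ℕ
open import Data.Fin using (Fin; zero; suc; inject₁; fromℕ; toℕ)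
import Data.Fin as F
open import Data.Fin.Properties using (toℕ-inject₁; toℕ-fromℕ; inject₁ℕ<; ≤fromℕ; <-irrefl)
open import Data.Fin.Relation.Unary.Top using (view; ‵fromℕ; ‵inject₁)
open import Data.Product using (_,_)
open import Data.Sum using (inj₁; inj₂)
open import Data.Empty using (⊥-elim)
open import Function.Base using (_∘_)
open import Function.Bundles using (_⇔_; mk⇔)
open import Relation.Nullary using (¬_)
open import Relation.Binary.PropositionalEquality using (_≡_; refl; subst; sym)

inject₁-mono-< : ∀ {n} {i j : Fin n} → i F.< j → inject₁ i F.< inject₁ j
inject₁-mono-< {i = i} {j} i<j rewrite toℕ-inject₁ i | toℕ-inject₁ j = i<j

inject₁-cancel-< : ∀ {n} {i j : Fin n} → inject₁ i F.< inject₁ j → i F.< j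
inject₁-cancel-< {i = i} {j} i<j rewrite toℕ-inject₁ i | toℕ-inject₁ j = i<j

inject₁<fromℕ : ∀ {n} (i : Fin n) → inject₁ i F.< fromℕ n
inject₁<fromℕ {n} i = subst (toℕ (inject₁ i) <_) (sym (toℕ-fromℕ n)) (inject₁ℕ< i)

fromℕ≮ : ∀ {n} (i : Fin (suc n)) → ¬ fromℕ n F.< i
fromℕ≮ i = ℕ.≤⇒≯ (≤fromℕ i)

πcell-fromℕ : ∀ m j → πcell (fromℕ m , j) ≡ (zero , suc j)
πcell-fromℕ zero    j = refl
πcell-fromℕ (suc m) j rewrite πcell-fromℕ m j = refl

πcell-inject₁ : ∀ {m} (i : Fin m) j → πcell (inject₁ i , j) ≡ (suc i , j)
πcell-inject₁ {suc m} zero    j = refl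
πcell-inject₁ {suc m} (suc i) j rewrite πcell-inject₁ i j = refl

∉arm-own-row : ∀ {n} (μ : Comp n) i l j → ¬ ((i , l) ∈arm[ μ ] (i , j))
∉arm-own-row μ i l j (inj₁ (_ , refl , _ , i<i , _)) = <-irrefl refl i<i
∉arm-own-row μ i l j (inj₂ (_ , refl , _ , i<i , _)) = <-irrefl refl i<i

arm-π-inner-rows : ∀ {m} (μ : Comp (suc m)) (a i : Fin m) l j →
  (inject₁ a , l) ∈arm[ μ ] (inject₁ i , j) ⇔ (suc a , l) ∈arm[ πc μ ] (suc i , j)
arm-π-inner-rows μ a i l j = mk⇔ to from
  where
  to : (inject₁ a , l) ∈arm[ μ ] (inject₁ i , j) → (suc a , l) ∈arm[ πc μ ] (suc i , j)
  to (inj₁ (_ , refl , v∈μ , a<i , μa≤μi)) = inj₁ (_ , refl , v∈μ , s<s (inject₁-cancel-< a<i) , μa≤μi)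
  to (inj₂ (_ , refl , v∈μ , i<a , μa<μi)) = inj₂ (_ , refl , v∈μ , s<s (inject₁-cancel-< i<a) , μa<μi)

  from : (suc a , l) ∈arm[ πc μ ] (suc i , j) → (inject₁ a , l) ∈arm[ μ ] (inject₁ i , j)
  from (inj₁ (_ , refl , v∈μ , a<i , μa≤μi)) = inj₁ (_ , refl , v∈μ , inject₁-mono-< (s<s⁻¹ a<i) , μa≤μi)
  from (inj₂ (_ , refl , v∈μ , i<a , μa<μi)) = inj₂ (_ , refl , v∈μ , inject₁-mono-< (s<s⁻¹ i<a) , μa<μi)

arm-π-from-last-row : ∀ {m} (μ : Comp (suc m)) (a : Fin m) l j →
  (inject₁ a , l) ∈arm[ μ ] (fromℕ m , suc j) ⇔ (suc a , l) ∈arm[ πc μ ] (zero , suc (suc j))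
arm-π-from-last-row {m} μ a l j = mk⇔ to from
  where
  to : (inject₁ a , l) ∈arm[ μ ] (fromℕ m , suc j) → (suc a , l) ∈arm[ πc μ ] (zero , suc (suc j))
  to (inj₁ (_ , refl , (_ , l≤μa) , _ , μa≤μn)) = inj₂ (_ , refl , l≤μa , s<s z≤n , s≤s μa≤μn)
  to (inj₂ (_ , refl , _ , n<a , _)) = ⊥-elim (fromℕ≮ _ n<a)

  from : (suc a , l) ∈arm[ πc μ ] (zero , suc (suc j)) → (inject₁ a , l) ∈arm[ μ ] (fromℕ m , suc j)
  from (inj₁ (_ , refl , _ , () , _))
  from (inj₂ (_ , refl , l≤μa , _ , μa<1+μn)) = inj₁ (_ , refl , (s≤s z≤n , l≤μa) , inject₁<fromℕ a , s≤s⁻¹ μa<1+μn)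

arm-π-of-last-row : ∀ {m} (μ : Comp (suc m)) (i : Fin m) l j →
  (fromℕ m , l) ∈arm[ μ ] (inject₁ i , suc j) ⇔ (zero , suc l) ∈arm[ πc μ ] (suc i , suc j)
arm-π-of-last-row {m} μ i l j = mk⇔ to from
  where
  to : (fromℕ m , l) ∈arm[ μ ] (inject₁ i , suc j) → (zero , suc l) ∈arm[ πc μ ] (suc i , suc j)
  to (inj₁ (_ , refl , _ , n<i , _)) = ⊥-elim (fromℕ≮ _ n<i)
  to (inj₂ (_ , refl , l≤μn , _ , μn<μi)) = inj₁ (_ , refl , (s≤s z≤n , s≤s l≤μn) , s<s z≤n , μn<μi)

  from : (zero , suc l) ∈arm[ πc μ ] (suc i , suc j) → (fromℕ m , l) ∈arm[ μ ] (inject₁ i , suc j)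
  from (inj₁ (_ , refl , (_ , 1+l≤1+μn) , _ , μn<μi)) = inj₂ (_ , refl , s≤s⁻¹ 1+l≤1+μn , inject₁<fromℕ i , μn<μi)
  from (inj₂ (_ , refl , _ , () , _))

arm-π-last-row : ∀ {m} (μ : Comp (suc m)) l j →
  (fromℕ m , l) ∈arm[ μ ] (fromℕ m , j) ⇔ (zero , suc l) ∈arm[ πc μ ] (zero , suc j)
arm-π-last-row μ l j = mk⇔ (⊥-elim ∘ ∉arm-own-row μ _ l j) (⊥-elim ∘ ∉arm-own-row (πc μ) zero (suc l) (suc j))

-- The hypothesis v ∈dĝ μ is redundant (arm membership includes it); of u ∈dg′ μ only 1 ≤ j is needed.
lemma4p1 : (m : ℕ) (μ : Comp (suc m)) (u v : Cell (suc m)) →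
    u ∈dg′ μ → v ∈dĝ μ →
    (v ∈arm[ μ ] u) ⇔ (πcell v ∈arm[ πc μ ] πcell u)
lemma4p1 m μ (i , zero) (a , l) (() , _) _
lemma4p1 m μ (i , suc j) (a , l) _ _ with view a | view i
... | ‵inject₁ a | ‵inject₁ i rewrite πcell-inject₁ a l | πcell-inject₁ i (suc j) = arm-π-inner-rows μ a i l (suc j)
... | ‵inject₁ a | ‵fromℕ     rewrite πcell-inject₁ a l | πcell-fromℕ m (suc j)   = arm-π-from-last-row μ a l j
... | ‵fromℕ     | ‵inject₁ i rewrite πcell-fromℕ m l   | πcell-inject₁ i (suc j) = arm-π-of-last-row μ i l j
... | ‵fromℕ     | ‵fromℕ     rewrite πcell-fromℕ m l   | πcell-fromℕ m (suc j)   = arm-π-last-row μ l (suc j)
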